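{- Let $P$ be a finite ranked poset of rank $n$ with minimum $\hat0$ and maximum $\hat1$, and suppose $P$ has an $S$-labeling $\Lambda:\mathcal M(P)\to L^n$. Then the set $\Lambda(\mathcal M(P))$ is stable under the action of $S_n$ on $L^n$ by permuting coordinates, and the resulting action of $S_n$ on $\mathcal M(P)$ (defined by $\Lambda(\pi\cdot c)=\pi\cdot\Lambda(c)$) is a local permutation action: for every adjacent transposition $\sigma_i=(i,i+1)$ and every $c\in\mathcal M(P)$, the chain $\sigma_i\cdot c$ differs from $c$ at most in its element of rank $i$.
   Context: $\mathcal M(P)$ denotes the set of maximal chains of $P$; $L$ is a totally ordered set. A labeling $\Lambda:\mathcal M(P)\to L^n$, $\Lambda(c)=(\Lambda_1(c),\dots,\Lambda_n(c))$, is an $S$-labeling if it is injective and, for every maximal chain $c=(\hat0=w^0\lessdot w^1\lessdot\cdots\lessdot w^n=\hat1)$ and every $i\in\{1,\dots,n-1\}$ with $\Lambda_i(c)\ne\Lambda_{i+1}(c)$, there is a unique maximal chain $c'$ differing from $c$ only in its element of rank $i$ such that $\Lambda(c')$ is obtained from $\Lambda(c)$ by interchanging the entries in positions $i$ and $i+1$. -}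

module Defs where

open import Level using (Level; _⊔_) renaming (suc to lsuc)
open import Data.Nat using (ℕ; zero; suc)
open import Data.Fin using (Fin; toℕ; fromℕ; inject₁) renaming (zero to fzero; suc to fsuc)
open import Data.Fin.Permutation using (Permutation′; _⟨$⟩ˡ_; transpose)
open import Data.Vec using (Vec; lookup; tabulate)
open import Data.Product using (Σ; _×_; _,_)
open import Data.Sum using (_⊎_)
open import Function.Bundles using (_↔_)
open import Relation.Binary.Core using (Rel)
open import Relation.Binary.Structures using (IsPartialOrder)
open import Relation.Binary.PropositionalEquality using (_≡_; _≢_)

record FiniteRankedPoset (c ℓ : Level) (n : ℕ) : Set (lsuc (c ⊔ ℓ)) where
  field
    Carrier        : Set c
    _≤_            : Rel Carrier ℓ
    isPartialOrder : IsPartialOrder _≡_ _≤_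
    size           : ℕ
    finite         : Carrier ↔ Fin size
    0̂              : Carrier
    1̂              : Carrier
    0̂-minimum      : ∀ x → 0̂ ≤ x
    1̂-maximum      : ∀ x → x ≤ 1̂

  _⋖_ : Carrier → Carrier → Set (c ⊔ ℓ)
  x ⋖ y = (x ≤ y) × (x ≢ y) × (∀ z → x ≤ z → z ≤ y → (z ≡ x) ⊎ (z ≡ y))

  field
    rank       : Carrier → ℕ
    rank-0̂     : rank 0̂ ≡ 0
    rank-1̂     : rank 1̂ ≡ n
    rank-cover : ∀ {x y} → x ⋖ y → rank y ≡ suc (rank x)

module _ {c ℓ : Level} {n : ℕ} (P : FiniteRankedPoset c ℓ n) where
  open FiniteRankedPoset P

  -- A maximal chain  0̂ = w⁰ ⋖ w¹ ⋖ ⋯ ⋖ wⁿ = 1̂ ; its element of rank i is lookup elems i.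
  record MaximalChain : Set (c ⊔ ℓ) where
    field
      elems  : Vec Carrier (suc n)
      start  : lookup elems fzero ≡ 0̂
      end    : lookup elems (fromℕ n) ≡ 1̂
      covers : ∀ (j : Fin n) → lookup elems (inject₁ j) ⋖ lookup elems (fsuc j)
  open MaximalChain public

  AgreeExcept : MaximalChain → MaximalChain → Fin (suc n) → Set c
  AgreeExcept c₁ c₂ r = ∀ s → s ≢ r → lookup (elems c₂) s ≡ lookup (elems c₁) s

-- action of S_n on L^n by permuting coordinates: (π · x)_j = x_{π⁻¹(j)}
permute : ∀ {a} {L : Set a} {n : ℕ} → Permutation′ n → Vec L n → Vec L n
permute π x = tabulate (λ j → lookup x (π ⟨$⟩ˡ j))

-- Labels are 0-indexed: label j : Fin n is on the cover w^j ⋖ w^{j+1}.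
-- Paper's positions i, i+1 (1 ≤ i ≤ n-1) are our j, j' with toℕ j' = toℕ j + 1,
-- and the element of rank i is at index fsuc j.
IsSLabeling : ∀ {c ℓ a} {n : ℕ} (P : FiniteRankedPoset c ℓ n) {L : Set a}
              → (MaximalChain P → Vec L n) → Set (c ⊔ ℓ ⊔ a)
IsSLabeling {n = n} P {L} Λ =
  (∀ c₁ c₂ → Λ c₁ ≡ Λ c₂ → elems c₁ ≡ elems c₂)
  × (∀ (c : MaximalChain P) (j j' : Fin n) → toℕ j' ≡ suc (toℕ j)
       → lookup (Λ c) j ≢ lookup (Λ c) j'
       → Σ (MaximalChain P) λ c' →
           (AgreeExcept P c c' (fsuc j) × Λ c' ≡ permute (transpose j j') (Λ c))
           × (∀ c'' → AgreeExcept P c c'' (fsuc j)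
                    → Λ c'' ≡ permute (transpose j j') (Λ c)
                    → elems c'' ≡ elems c'))

{-# OPTIONS --safe #-}
-- The image Λ(𝓜(P)) is closed under each adjacent transposition σ: if the two labels
-- that σ swaps are equal, σ fixes the word, and otherwise the S-labeling supplies a
-- chain carrying the swapped word. Closure under all of Sₙ follows by induction on n:
-- the first entry of π·v is some entry of v, which adjacent swaps carry to the front,
-- and the remaining entries are a reindexing of the rest of v. Locality holds because
-- Λ is injective, so σ·c is c itself or the chain supplied by the S-labeling.
module Submission where

open import Defs
open import Level using (_⊔_)
open import Data.Nat using (ℕ; suc)
open import Data.Fin using (Fin; toℕ; punchOut) renaming (zero to fzero; suc to fsuc)
open import Data.Fin.Properties using (0≢1+n; suc-injective; punchOut-injective) renaming (_≟_ to _≟ᶠ_)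
import Data.Fin.Permutation.Components as PC
open import Data.Fin.Permutation using (Permutation′; transpose; flip; _⟨$⟩ˡ_; lift₀-transpose)
open import Data.Vec using (Vec; []; _∷_; lookup; removeAt)
open import Data.Vec.Properties using (lookup∘tabulate; tabulate∘lookup; tabulate-cong; removeAt-punchOut)
open import Data.Product using (Σ; _×_; _,_; proj₁; proj₂)
open import Function using (_∘_; Injection)
open import Function.Definitions using (Injective)
open import Function.Properties.Inverse using (↔⇒↣)
open import Relation.Binary.Core using (Rel)
open import Relation.Binary.Definitions using (DecidableEquality)
open import Relation.Binary.Structures using (IsStrictTotalOrder)
open import Relation.Binary.PropositionalEquality using (_≡_; _≢_; refl; sym; trans; cong; subst)
open import Relation.Nullary using (yes; no)

Adjacent : ∀ {n} → Fin n → Fin n → Set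
Adjacent j j' = toℕ j' ≡ suc (toℕ j)

module _ {a} {L : Set a} where

  lookup-transpose-fixed : ∀ {n} (v : Vec L n) {i j} → lookup v i ≡ lookup v j →
                           ∀ k → lookup v (PC.transpose i j k) ≡ lookup v k
  lookup-transpose-fixed v {i} {j} vᵢ≡vⱼ k with k ≟ᶠ i
  ... | yes refl = sym vᵢ≡vⱼ
  ... | no _ with k ≟ᶠ j
  ...   | yes refl = vᵢ≡vⱼ
  ...   | no _ = refl

  permute-transpose-fixed : ∀ {n} {v : Vec L n} {i j} → lookup v i ≡ lookup v j →
                            permute (transpose i j) v ≡ v
  permute-transpose-fixed {v = v} vᵢ≡vⱼ =
    trans (tabulate-cong (lookup-transpose-fixed v (sym vᵢ≡vⱼ))) (tabulate∘lookup v)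

  permute-transpose-head : ∀ {n} (x y : L) (zs : Vec L n) →
                           permute (transpose fzero (fsuc fzero)) (x ∷ y ∷ zs) ≡ y ∷ x ∷ zs
  permute-transpose-head x y zs = cong (λ ws → y ∷ x ∷ ws) (tabulate∘lookup zs)

  permute-transpose-suc : ∀ {n} (i j : Fin n) (x : L) (xs : Vec L n) →
                          permute (transpose (fsuc i) (fsuc j)) (x ∷ xs) ≡ x ∷ permute (transpose i j) xs
  permute-transpose-suc i j x xs = tabulate-cong (cong (lookup (x ∷ xs)) ∘ lift₀-transpose j i)

  AdjacentTranspositionClosed : ∀ {n r} → (Vec L n → Set r) → Set (a ⊔ r)
  AdjacentTranspositionClosed R =
    ∀ {j j'} → Adjacent j j' → ∀ {v} → R v → R (permute (transpose j j') v)

  ∷-adjacentTranspositionClosed : ∀ {n r} {R : Vec L (suc n) → Set r} →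
    AdjacentTranspositionClosed R → ∀ x → AdjacentTranspositionClosed (R ∘ (x ∷_))
  ∷-adjacentTranspositionClosed {R = R} closed x {j} {j'} adj {v} r =
    subst R (permute-transpose-suc j j' x v) (closed (cong suc adj) r)

  moveToFront-closed : ∀ {n r} {R : Vec L (suc n) → Set r} → AdjacentTranspositionClosed R →
                       ∀ {v} p → R v → R (lookup v p ∷ removeAt v p)
  moveToFront-closed _ {x ∷ xs} fzero r = r
  moveToFront-closed {R = R} closed {x ∷ y ∷ ys} (fsuc p) r =
    subst R (permute-transpose-head x _ _) (closed {fzero} {fsuc fzero} refl
      (moveToFront-closed (∷-adjacentTranspositionClosed closed x) p r))

  reindex-closed : ∀ {n r} {R : Vec L n → Set r} → AdjacentTranspositionClosed R →
                   ∀ {v w} (f : Fin n → Fin n) → Injective _≡_ _≡_ f →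
                   (∀ k → lookup w k ≡ lookup v (f k)) → R v → R w
  reindex-closed _ {[]} {[]} _ _ _ r = r
  reindex-closed {suc n} {R = R} closed {v} {w₀ ∷ ws} f f-inj w≗v∘f r =
    subst (λ x → R (x ∷ ws)) (sym (w≗v∘f fzero))
      (reindex-closed (∷-adjacentTranspositionClosed closed (lookup v p)) g g-inj ws≗rest∘g
        (moveToFront-closed closed p r))
    where
    p : Fin (suc n)
    p = f fzero
    p≢f[1+k] : ∀ k → p ≢ f (fsuc k)
    p≢f[1+k] k = 0≢1+n ∘ f-inj
    g : Fin n → Fin n
    g k = punchOut (p≢f[1+k] k)
    g-inj : Injective _≡_ _≡_ g
    g-inj {k} {l} = suc-injective ∘ f-inj ∘ punchOut-injective (p≢f[1+k] k) (p≢f[1+k] l)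
    ws≗rest∘g : ∀ k → lookup ws k ≡ lookup (removeAt v p) (g k)
    ws≗rest∘g k = trans (w≗v∘f (fsuc k)) (sym (removeAt-punchOut v (p≢f[1+k] k)))

  permute-closed : ∀ {n r} {R : Vec L n → Set r} → AdjacentTranspositionClosed R →
                   ∀ π {v} → R v → R (permute π v)
  permute-closed closed π =
    reindex-closed closed (π ⟨$⟩ˡ_) (Injection.injective (↔⇒↣ (flip π))) (lookup∘tabulate _)

module _ {c ℓ a} {n : ℕ} (P : FiniteRankedPoset c ℓ n) {L : Set a} (_≟_ : DecidableEquality L)
         {Λ : MaximalChain P → Vec L n} (isSLabeling : IsSLabeling P Λ) where

  private
    Λ-injective = proj₁ isSLabeling
    Λ-swap      = proj₂ isSLabeling

  IsLabel : Vec L n → Set (c ⊔ ℓ ⊔ a)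
  IsLabel v = Σ (MaximalChain P) λ ch → Λ ch ≡ v

  transpose-chain : ∀ {j j'} → Adjacent j j' → ∀ ch → Σ (MaximalChain P) λ ch' →
                    AgreeExcept P ch ch' (fsuc j) × Λ ch' ≡ permute (transpose j j') (Λ ch)
  transpose-chain {j} {j'} adj ch with lookup (Λ ch) j ≟ lookup (Λ ch) j'
  ... | yes Λⱼ≡Λⱼ' = ch , (λ _ _ → refl) , sym (permute-transpose-fixed Λⱼ≡Λⱼ')
  ... | no Λⱼ≢Λⱼ' with Λ-swap ch j j' adj Λⱼ≢Λⱼ'
  ...   | ch' , agree×Λch'≡ , _ = ch' , agree×Λch'≡

  isLabel-adjacentTranspositionClosed : AdjacentTranspositionClosed IsLabel
  isLabel-adjacentTranspositionClosed adj (ch , refl) =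
    let ch' , _ , Λch'≡ = transpose-chain adj ch in ch' , Λch'≡

  transpose-agreeExcept : ∀ {j j'} → Adjacent j j' → ∀ ch ch' →
                          Λ ch' ≡ permute (transpose j j') (Λ ch) → AgreeExcept P ch ch' (fsuc j)
  transpose-agreeExcept adj ch ch' Λch'≡ s s≢j+1 =
    let ch'' , agree , Λch''≡ = transpose-chain adj ch
        ch'≡ch'' = Λ-injective ch' ch'' (trans Λch'≡ (sym Λch''≡))
    in trans (cong (λ cs → lookup cs s) ch'≡ch'') (agree s s≢j+1)

theorem4p1 : ∀ {c ℓ a ℓ'} {n : ℕ} (P : FiniteRankedPoset c ℓ n)
    (L : Set a) (_<_ : Rel L ℓ') → IsStrictTotalOrder _≡_ _<_
    → (Λ : MaximalChain P → Vec L n) → IsSLabeling P Λ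
    → (∀ (π : Permutation′ n) (ch : MaximalChain P) →
         Σ (MaximalChain P) λ ch' → Λ ch' ≡ permute π (Λ ch))
      × (∀ (j j' : Fin n) → toℕ j' ≡ suc (toℕ j) →
         ∀ (ch ch' : MaximalChain P) → Λ ch' ≡ permute (transpose j j') (Λ ch) →
         AgreeExcept P ch ch' (fsuc j))
theorem4p1 P L _<_ isSTO Λ isSLabeling =
    (λ π ch → permute-closed (isLabel-adjacentTranspositionClosed P _≟_ isSLabeling) π (ch , refl))
  , (λ j j' adj → transpose-agreeExcept P _≟_ isSLabeling adj)
  where open IsStrictTotalOrder isSTO using (_≟_)
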